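{- For any Dyck path $d$ of semilength $n$, $\min\{\mathrm{des}(d,\sigma) \mid \sigma\in\mathfrak{S}_n\} = \mathrm{bpk}(d) - \mathrm{lpk}(d)$.
   Context: A Dyck path of semilength $n$ is a lattice path from $(0,0)$ to $(2n,0)$ with steps $U=(1,1)$ and $D=(1,-1)$ never going below the $x$-axis. A peak is an occurrence of $UD$; a low peak is a peak whose steps touch the $x$-axis; $\mathrm{lpk}(d)$ is the number of low peaks. The bounce path of $d$: start at $(0,0)$, take up-steps until reaching a point of $d$ where $d$'s next step is a down-step, then take down-steps to the $x$-axis, then up-steps until again meeting a down-step of $d$, and so on until $(2n,0)$; $\mathrm{bpk}(d)$ is its number of peaks. For $\sigma=\sigma_1\cdots\sigma_n\in\mathfrak{S}_n$, $\mathrm{can}(d,\sigma)$ is the word of length $2n$ obtained by labeling the $i$-th up-step and the $i$-th down-step of $d$ with $\sigma_i$ and reading left to right; $\mathrm{des}(d,\sigma)$ is the number of $j\in[2n-1]$ with $\mathrm{can}(d,\sigma)_j>\mathrm{can}(d,\sigma)_{j+1}$. -}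

module Defs where

open import Data.Nat using (ℕ; zero; suc; _+_; _*_; _<ᵇ_; _≡ᵇ_; pred; _<?_)
open import Data.Bool using (Bool; true; false; if_then_else_; _∧_)
open import Data.List using (List; []; _∷_; length)
open import Data.Fin using (Fin; toℕ; fromℕ<)
open import Data.Fin.Permutation using (Permutation′; _⟨$⟩ʳ_)
open import Data.Empty using (⊥)
open import Data.Unit using (⊤)
open import Data.Product using (_×_)
open import Relation.Nullary using (yes; no)
open import Relation.Binary.PropositionalEquality using (_≡_)

-- Steps of a lattice path: U = (1,1), D = (1,-1)
data Step : Set where
  U D : Step

ValidFrom : ℕ → List Step → Set
ValidFrom zero    []      = ⊤
ValidFrom (suc h) []      = ⊥
ValidFrom h       (U ∷ s) = ValidFrom (suc h) s
ValidFrom zero    (D ∷ s) = ⊥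
ValidFrom (suc h) (D ∷ s) = ValidFrom h s

IsDyck : ℕ → List Step → Set
IsDyck n d = (length d ≡ 2 * n) × ValidFrom 0 d

peaks : List Step → ℕ
peaks []            = 0
peaks (U ∷ D ∷ s)   = suc (peaks (D ∷ s))
peaks (_ ∷ s)       = peaks s

lowPeaksFrom : ℕ → List Step → ℕ
lowPeaksFrom h []              = 0
lowPeaksFrom zero (U ∷ D ∷ s)  = suc (lowPeaksFrom zero s)
lowPeaksFrom h (U ∷ s)         = lowPeaksFrom (suc h) s
lowPeaksFrom h (D ∷ s)         = lowPeaksFrom (pred h) s

lpk : List Step → ℕ
lpk d = lowPeaksFrom 0 d

height-after : ℕ → Step → ℕ
height-after h U = suc h
height-after h D = pred h

isD : Step → Bool
isD U = false
isD D = true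

-- Arguments: current height h of d, current height b of the bounce path,
-- remaining steps of d.  In "up" mode the bounce path takes up-steps until it
-- reaches a point of d (b = h) at which d's next step is a down-step; it then
-- switches to "down" mode and takes down-steps until reaching the x-axis,
-- where it switches back to "up" mode.
data Mode : Set where
  up down : Mode

mutual
  bounceGo : Mode → ℕ → ℕ → List Step → List Step
  bounceGo m    h b       []      = []
  bounceGo down h (suc b) (x ∷ s) = D ∷ bounceGo down (height-after h x) b s
  bounceGo down h zero    (x ∷ s) = bounceUp h zero x s
  bounceGo up   h b       (x ∷ s) = bounceUp h b x s

  bounceUp : ℕ → ℕ → Step → List Step → List Step
  bounceUp h b x s =
    if (h ≡ᵇ b) ∧ isD x
    then D ∷ bounceGo down (height-after h x) (pred b) s
    else U ∷ bounceGo up (height-after h x) (suc b) s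

bounce : List Step → List Step
bounce d = bounceGo up 0 0 d

bpk : List Step → ℕ
bpk d = peaks (bounce d)

-- σ_i (0-based index i) as a natural number; 0 outside the range (never used
-- for Dyck paths of semilength n)
label : {n : ℕ} → Permutation′ n → ℕ → ℕ
label {n} σ i with i <? n
... | yes p = toℕ (σ ⟨$⟩ʳ fromℕ< p)
... | no _  = 0

-- labelling: the i-th up-step and the i-th down-step both get σ_i
-- (iu / id = number of up / down steps seen so far)
canFrom : (ℕ → ℕ) → ℕ → ℕ → List Step → List ℕ
canFrom f iu id []      = []
canFrom f iu id (U ∷ s) = f iu ∷ canFrom f (suc iu) id s
canFrom f iu id (D ∷ s) = f id ∷ canFrom f iu (suc id) s

can : {n : ℕ} → List Step → Permutation′ n → List ℕ
can d σ = canFrom (label σ) 0 0 d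

descents : List ℕ → ℕ
descents []            = 0
descents (a ∷ [])      = 0
descents (a ∷ b ∷ w)   = (if b <ᵇ a then 1 else 0) + descents (b ∷ w)

des : {n : ℕ} → List Step → Permutation′ n → ℕ
des d σ = descents (can d σ)

-- The bounce path splits the up steps of d into consecutive blocks [M₀,M₁), [M₁,M₂), …, where
-- M₀ = 0 and M_{j+1} is the number of up steps before the down step D_{M_j}; bpk counts the blocks
-- and lpk those consisting of one up step immediately followed by its down step.  Labelling the
-- i-th up and down steps by i, a permutation σ is just an order on these indices.
-- Lower bound: the stretch of the word from U_M to D_M, M the first index of a block, carries the
-- same label at both ends, so it contains a descent unless it is the low peak U_M D_M; these
-- stretches are disjoint.
-- Upper bound: make each up step U_i a child of the last down step before it and order the indices
-- in preorder of this forest (lexicographic order of root paths, the keys below).  Then the word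
-- can only descend right before the first down step of a block, and not at all at a low peak.

module Submission where

open import Defs
open import Data.Bool using (Bool; true; false; if_then_else_; _∧_)
open import Data.Bool.Properties using (∧-zeroʳ)
open import Data.Fin using (Fin; toℕ; fromℕ<; punchOut) renaming (_<_ to _<ᶠ_)
open import Data.Fin.Permutation using (Permutation′; permutation; _⟨$⟩ʳ_; _⟨$⟩ˡ_; inverseˡ)
open import Data.Fin.Properties
  using (any?; punchOut-injective; injective⇒≤; toℕ-fromℕ<; toℕ-injective)
  renaming (_≟_ to _≟ᶠ_; <⇒≢ to <ᶠ⇒≢)
open import Data.Fin.Subset using (Subset; _∈_; _⊂_; ⊤; ∣_∣)
open import Data.Fin.Subset.Properties using (p⊂q⇒∣p∣<∣q∣; ∣⊤∣≡n; ∈⊤)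
open import Data.List using (List; []; _∷_; _++_; _∷ʳ_; length; map)
open import Data.List.Properties using (++-identityʳ)
open import Data.List.Relation.Binary.Lex.Strict using (Lex-<; halt; this; next; <-transitive; <-compare)
open import Data.List.Relation.Binary.Pointwise using (Pointwise-≡⇒≡; ≡⇒Pointwise-≡)
open import Data.List.Relation.Unary.All using (All; []; _∷_)
open import Data.Nat using (ℕ; zero; suc; _+_; _*_; pred; _<_; _≤_; _<?_; _≡ᵇ_; z≤n; s≤s)
open import Data.Nat.Properties
  using ( _≟_; suc-injective; +-suc; +-identityʳ; *-cancelˡ-≡; +-mono-≤; +-monoʳ-≤; +-monoˡ-≤
        ; m≤n+m; m≤m+n; n≤1+n; n<1+n; m<n⇒m<1+n; m<1+n⇒m<n∨m≡n; ≤-pred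
        ; ≤-refl; ≤-reflexive; ≤-trans; ≤-antisym; <-trans; <-≤-trans; ≤-<-trans
        ; <-irrefl; <-asym; <⇒≢; <-cmp; <-resp₂-≡; <-isStrictTotalOrder; module ≤-Reasoning )
open import Data.Product using (Σ; ∃; _×_; _,_; proj₁; proj₂)
open import Data.Product.Relation.Binary.Lex.Strict using (×-Lex; ×-transitive; ×-compare)
open import Data.Sum using (_⊎_; inj₁; inj₂)
open import Data.Vec using (tabulate)
open import Data.Vec.Properties using (lookup∘tabulate; []=⇒lookup; lookup⇒[]=)
open import Function using (_∘_; _⇔_; mk⇔; Equivalence; Injective; case_of_)
open import Level using (0ℓ)
open import Relation.Binary
  using (Rel; Decidable; Trichotomous; tri<; tri≈; tri>; IsStrictTotalOrder; isStrictTotalOrderᶜ)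
open import Relation.Binary.PropositionalEquality
  using ( _≡_; _≢_; refl; sym; trans; cong; cong₂; subst; subst₂; ≢-sym; isEquivalence
        ; module ≡-Reasoning )
open import Relation.Nullary using (¬_; Dec; yes; no; does; contradiction)
open import Relation.Nullary.Decidable using (dec-true; dec-false; does-⇔)

-- Strict total orders and ranking permutations

tri-≈⇒≡ : ∀ {A : Set} {_≈_ _<_ : Rel A 0ℓ} → (∀ {x y} → x ≈ y ⇔ x ≡ y) →
          Trichotomous _≈_ _<_ → Trichotomous _≡_ _<_
tri-≈⇒≡ ≈⇔≡ cmp x y with cmp x y
... | tri< a ¬b ¬c = tri< a (¬b ∘ Equivalence.from ≈⇔≡) ¬c
... | tri≈ ¬a b ¬c = tri≈ ¬a (Equivalence.to ≈⇔≡ b) ¬c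
... | tri> ¬a ¬b c = tri> ¬a (¬b ∘ Equivalence.from ≈⇔≡) c

infix 4 _<ₖ_
_<ₖ_ : Rel (List ℕ) 0ℓ
_<ₖ_ = Lex-< _≡_ _<_

<ₖ-isStrictTotalOrder : IsStrictTotalOrder _≡_ _<ₖ_
<ₖ-isStrictTotalOrder = isStrictTotalOrderᶜ record
  { isEquivalence = isEquivalence
  ; trans         = <-transitive isEquivalence <-resp₂-≡ <-trans
  ; compare       = tri-≈⇒≡ (mk⇔ Pointwise-≡⇒≡ ≡⇒Pointwise-≡) (<-compare sym <-cmp)
  }

<ₖ-trans : ∀ {xs ys zs} → xs <ₖ ys → ys <ₖ zs → xs <ₖ zs
<ₖ-trans = IsStrictTotalOrder.trans <ₖ-isStrictTotalOrder

<ₖ-snoc : ∀ xs t → xs <ₖ xs ∷ʳ t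
<ₖ-snoc []       t = halt
<ₖ-snoc (x ∷ xs) t = next refl (<ₖ-snoc xs t)

<ₖ-last : ∀ xs {s t} → s < t → xs ∷ʳ s <ₖ xs ∷ʳ t
<ₖ-last []       s<t = this s<t
<ₖ-last (x ∷ xs) s<t = next refl (<ₖ-last xs s<t)

<ₖ-++ : ∀ {xs ys} → length xs ≡ length ys → xs <ₖ ys → ∀ zs ws → xs ++ zs <ₖ ys ++ ws
<ₖ-++ _   (this x<y)     zs ws = this x<y
<ₖ-++ len (next x≡y xs<ys) zs ws = next x≡y (<ₖ-++ (suc-injective len) xs<ys zs ws)

<ₖ-++ˡ : ∀ {xs ys} → length xs ≡ length ys → xs <ₖ ys → ∀ zs → xs ++ zs <ₖ ys
<ₖ-++ˡ {xs} {ys} len xs<ys zs = subst (xs ++ zs <ₖ_) (++-identityʳ ys) (<ₖ-++ len xs<ys zs [])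

module _ {A : Set} {_≺_ : Rel A 0ℓ} (≺-sto : IsStrictTotalOrder _≡_ _≺_) where
  open IsStrictTotalOrder ≺-sto using (<-resp-≈; compare) renaming (trans to ≺-trans)

  ByKey : (ℕ → A) → Rel ℕ 0ℓ
  ByKey κ i j = ×-Lex _≡_ _≺_ _<_ (κ i , i) (κ j , j)

  byKey-isStrictTotalOrder : (κ : ℕ → A) → IsStrictTotalOrder _≡_ (ByKey κ)
  byKey-isStrictTotalOrder κ = isStrictTotalOrderᶜ record
    { isEquivalence = isEquivalence
    ; trans         = λ {i j k} → ×-transitive isEquivalence <-resp-≈ ≺-trans <-trans
                                        {κ i , i} {κ j , j} {κ k , k}
    ; compare       = tri-≈⇒≡ {_≈_ = λ i j → κ i ≡ κ j × i ≡ j} (mk⇔ proj₂ λ { refl → refl , refl })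
                        (λ i j → ×-compare sym compare <-cmp (κ i , i) (κ j , j))
    }

restrict-isStrictTotalOrder : ∀ {_⊏_ : Rel ℕ 0ℓ} → IsStrictTotalOrder _≡_ _⊏_ →
                              ∀ n → IsStrictTotalOrder _≡_ (λ (i j : Fin n) → toℕ i ⊏ toℕ j)
restrict-isStrictTotalOrder ⊏-sto n = isStrictTotalOrderᶜ record
  { isEquivalence = isEquivalence
  ; trans         = IsStrictTotalOrder.trans ⊏-sto
  ; compare       = tri-≈⇒≡ (mk⇔ toℕ-injective (cong toℕ))
                      (λ i j → IsStrictTotalOrder.compare ⊏-sto (toℕ i) (toℕ j))
  }

injective⇒surjective : ∀ {n} (f : Fin n → Fin n) → Injective _≡_ _≡_ f →
                       ∀ k → Σ (Fin n) λ i → f i ≡ k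
injective⇒surjective {suc m} f f-inj k with any? (λ i → f i ≟ᶠ k)
... | yes found = found
... | no  none  = contradiction (injective⇒≤ skip-k-injective) (<-irrefl refl)
  where
  k≢f : ∀ i → k ≢ f i
  k≢f i k≡fi = none (i , sym k≡fi)
  skip-k-injective : Injective _≡_ _≡_ (λ i → punchOut (k≢f i))
  skip-k-injective {i} {j} = f-inj ∘ punchOut-injective (k≢f i) (k≢f j)

injective⇒permutation : ∀ {n} (f : Fin n → Fin n) → Injective _≡_ _≡_ f →
                        Σ (Permutation′ n) λ π → ∀ i → π ⟨$⟩ʳ i ≡ f i
injective⇒permutation f f-inj = permutation f f⁻¹ f∘f⁻¹ f⁻¹∘f , λ _ → refl
  where
  f⁻¹ : Fin _ → Fin _
  f⁻¹ = proj₁ ∘ injective⇒surjective f f-inj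
  f∘f⁻¹ : ∀ k → f (f⁻¹ k) ≡ k
  f∘f⁻¹ = proj₂ ∘ injective⇒surjective f f-inj
  f⁻¹∘f : ∀ i → f⁻¹ (f i) ≡ i
  f⁻¹∘f i = f-inj (f∘f⁻¹ (f i))

module Ranking {n : ℕ} {_⊏_ : Rel (Fin n) 0ℓ} (⊏-sto : IsStrictTotalOrder _≡_ _⊏_) where
  open IsStrictTotalOrder ⊏-sto using (irrefl; compare) renaming (_<?_ to _⊏?_; trans to ⊏-trans)

  predecessors : Fin n → Subset n
  predecessors i = tabulate (λ j → does (j ⊏? i))

  ∈-predecessors⁺ : ∀ {i j} → j ⊏ i → j ∈ predecessors i
  ∈-predecessors⁺ {i} {j} j⊏i =
    lookup⇒[]= j (predecessors i) (trans (lookup∘tabulate _ j) (dec-true (j ⊏? i) j⊏i))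

  ∈-predecessors⁻ : ∀ {i j} → j ∈ predecessors i → j ⊏ i
  ∈-predecessors⁻ {i} {j} j∈ = witness (j ⊏? i) (trans (sym (lookup∘tabulate _ j)) ([]=⇒lookup j∈))
    where
    witness : ∀ {P : Set} (P? : Dec P) → does P? ≡ true → P
    witness (yes p) _ = p

  predecessors-⊂ : ∀ {i k} → i ⊏ k → predecessors i ⊂ predecessors k
  predecessors-⊂ {i} i⊏k =
    (∈-predecessors⁺ ∘ (λ j⊏i → ⊏-trans j⊏i i⊏k) ∘ ∈-predecessors⁻) ,
    i , ∈-predecessors⁺ i⊏k , irrefl refl ∘ ∈-predecessors⁻

  rank<n : ∀ i → ∣ predecessors i ∣ < n
  rank<n i = subst (∣ predecessors i ∣ <_) (∣⊤∣≡n n)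
    (p⊂q⇒∣p∣<∣q∣ ((λ _ → ∈⊤) , i , ∈⊤ , irrefl refl ∘ ∈-predecessors⁻))

  rank : Fin n → Fin n
  rank i = fromℕ< (rank<n i)

  rank-monotone : ∀ {i j} → i ⊏ j → rank i <ᶠ rank j
  rank-monotone {i} {j} i⊏j = subst₂ _<_ (sym (toℕ-fromℕ< (rank<n i))) (sym (toℕ-fromℕ< (rank<n j)))
    (p⊂q⇒∣p∣<∣q∣ (predecessors-⊂ i⊏j))

  rank-injective : Injective _≡_ _≡_ rank
  rank-injective {i} {j} rank-i≡rank-j with compare i j
  ... | tri< i⊏j _ _ = contradiction rank-i≡rank-j (<ᶠ⇒≢ (rank-monotone i⊏j))
  ... | tri≈ _ i≡j _ = i≡j
  ... | tri> _ _ j⊏i = contradiction (sym rank-i≡rank-j) (<ᶠ⇒≢ (rank-monotone j⊏i))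

  rankPermutation : Σ (Permutation′ n) λ σ → ∀ {i j} → i ⊏ j → σ ⟨$⟩ʳ i <ᶠ σ ⟨$⟩ʳ j
  rankPermutation with σ , σ≗rank ← injective⇒permutation rank rank-injective =
    σ , λ {i} {j} i⊏j → subst₂ _<ᶠ_ (sym (σ≗rank i)) (sym (σ≗rank j)) (rank-monotone i⊏j)

-- Descents of index words

indicator≤1 : ∀ b → (if b then 1 else 0) ≤ 1
indicator≤1 true  = s≤s z≤n
indicator≤1 false = z≤n

module _ {_≺_ : Rel ℕ 0ℓ} (_≺?_ : Decidable _≺_) where

  descentsAfter : ℕ → List ℕ → ℕ
  descentsAfter a []      = 0
  descentsAfter a (b ∷ w) = (if does (b ≺? a) then 1 else 0) + descentsAfter b w

  no-descent : ∀ {a b} → ¬ b ≺ a → (if does (b ≺? a) then 1 else 0) ≡ 0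
  no-descent {a} {b} b⊀a with b ≺? a
  ... | yes b≺a = contradiction b≺a b⊀a
  ... | no  _   = refl

  descentsBy : List ℕ → ℕ
  descentsBy []      = 0
  descentsBy (a ∷ w) = descentsAfter a w

descents-map : ∀ (f : ℕ → ℕ) w → descents (map f w) ≡ descentsBy (λ a b → f a <? f b) w
descents-map f []          = refl
descents-map f (a ∷ [])    = refl
descents-map f (a ∷ b ∷ w) = cong (_ +_) (descents-map f (b ∷ w))

module _ {n : ℕ} {_≺₁_ _≺₂_ : Rel ℕ 0ℓ} (≺₁? : Decidable _≺₁_) (≺₂? : Decidable _≺₂_)
         (agree : ∀ {a b} → a < n → b < n → a ≺₁ b ⇔ a ≺₂ b) where

  descentsAfter-cong : ∀ {a w} → a < n → All (_< n) w → descentsAfter ≺₁? a w ≡ descentsAfter ≺₂? a w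
  descentsAfter-cong a<n [] = refl
  descentsAfter-cong {a} {b ∷ w} a<n (b<n ∷ w<n) =
    cong₂ (λ x y → (if x then 1 else 0) + y) (does-⇔ (agree b<n a<n) (≺₁? b a) (≺₂? b a))
          (descentsAfter-cong b<n w<n)

  descentsBy-cong : ∀ {w} → All (_< n) w → descentsBy ≺₁? w ≡ descentsBy ≺₂? w
  descentsBy-cong []          = refl
  descentsBy-cong (a<n ∷ w<n) = descentsAfter-cong a<n w<n

indexWord : List Step → List ℕ
indexWord d = canFrom (λ i → i) 0 0 d

canFrom-map : ∀ (f : ℕ → ℕ) iu id s → canFrom f iu id s ≡ map f (canFrom (λ i → i) iu id s)
canFrom-map f iu id []      = refl
canFrom-map f iu id (U ∷ s) = cong (f iu ∷_) (canFrom-map f (suc iu) id s)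
canFrom-map f iu id (D ∷ s) = cong (f id ∷_) (canFrom-map f iu (suc id) s)

validFrom-U : ∀ h s → ValidFrom h (U ∷ s) → ValidFrom (suc h) s
validFrom-U zero    s v = v
validFrom-U (suc h) s v = v

suc-+-suc : ∀ {h r u} → h ≡ r + u → suc h ≡ r + suc u
suc-+-suc {r = r} {u} eh = trans (cong suc eh) (sym (+-suc r u))

ups downs : List Step → ℕ
ups []      = 0
ups (U ∷ s) = suc (ups s)
ups (D ∷ s) = ups s
downs []      = 0
downs (U ∷ s) = downs s
downs (D ∷ s) = suc (downs s)

downs≡height+ups : ∀ h s → ValidFrom h s → downs s ≡ h + ups s
downs≡height+ups zero    []      _ = refl
downs≡height+ups h       (U ∷ s) v =
  trans (downs≡height+ups (suc h) s (validFrom-U h s v)) (sym (+-suc h (ups s)))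
downs≡height+ups (suc h) (D ∷ s) v = cong suc (downs≡height+ups h s v)

length≡ups+downs : ∀ s → length s ≡ ups s + downs s
length≡ups+downs []      = refl
length≡ups+downs (U ∷ s) = cong suc (length≡ups+downs s)
length≡ups+downs (D ∷ s) = trans (cong suc (length≡ups+downs s)) (sym (+-suc (ups s) (downs s)))

dyck-ups : ∀ {n} d → IsDyck n d → ups d ≡ n
dyck-ups {n} d (length≡2n , valid) = *-cancelˡ-≡ (ups d) n 2 (begin
  2 * ups d         ≡⟨ cong (ups d +_) (+-identityʳ (ups d)) ⟩
  ups d + ups d     ≡⟨ cong (ups d +_) (downs≡height+ups 0 d valid) ⟨
  ups d + downs d   ≡⟨ length≡ups+downs d ⟨
  length d          ≡⟨ length≡2n ⟩
  2 * n             ∎)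
  where open ≡-Reasoning

dyck-downs : ∀ {n} d → IsDyck n d → downs d ≡ n
dyck-downs d dyck@(_ , valid) = trans (downs≡height+ups 0 d valid) (dyck-ups d dyck)

canFrom-bounded : ∀ {n} iu id s → iu + ups s ≤ n → id + downs s ≤ n →
                  All (_< n) (canFrom (λ i → i) iu id s)
canFrom-bounded iu id []      _ _ = []
canFrom-bounded iu id (U ∷ s) u≤ d≤ rewrite +-suc iu (ups s) =
  ≤-trans (s≤s (m≤m+n iu (ups s))) u≤ ∷ canFrom-bounded (suc iu) id s u≤ d≤
canFrom-bounded iu id (D ∷ s) u≤ d≤ rewrite +-suc id (downs s) =
  ≤-trans (s≤s (m≤m+n id (downs s))) d≤ ∷ canFrom-bounded iu (suc id) s u≤ d≤

indexWord-bounded : ∀ {n} d → IsDyck n d → All (_< n) (indexWord d)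
indexWord-bounded d dyck =
  canFrom-bounded 0 0 d (≤-reflexive (dyck-ups d dyck)) (≤-reflexive (dyck-downs d dyck))

-- Bounce blocks

-- Scans d keeping the current block [M, M + u) of up steps and the number r of down steps left
-- before D_M, which closes the block; a closed block is low iff it is one up step read just before
-- D_M, and w weighs blocks by lowness.  The scans below also count the up and down steps read so
-- far, iu and id, so that r + id ≡ M and u + M ≡ iu.
blockSum : (Bool → ℕ) → Bool → ℕ → ℕ → List Step → ℕ
blockSum w p u r       []      = 0
blockSum w p u r       (U ∷ s) = blockSum w true (suc u) r s
blockSum w p u zero    (D ∷ s) = w (p ∧ (u ≡ᵇ 1)) + blockSum w false 0 (pred u) s
blockSum w p u (suc r) (D ∷ s) = blockSum w false u r s

blocksFrom lowBlocksFrom highBlocksFrom : Bool → ℕ → ℕ → List Step → ℕ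
blocksFrom     = blockSum λ _   → 1
lowBlocksFrom  = blockSum λ low → if low then 1 else 0
highBlocksFrom = blockSum λ low → if low then 0 else 1

blocks lowBlocks highBlocks : List Step → ℕ
blocks     = blocksFrom false 0 0
lowBlocks  = lowBlocksFrom false 0 0
highBlocks = highBlocksFrom false 0 0

blocksFrom≡high+low : ∀ p u r s → blocksFrom p u r s ≡ highBlocksFrom p u r s + lowBlocksFrom p u r s
blocksFrom≡high+low p u r       []      = refl
blocksFrom≡high+low p u r       (U ∷ s) = blocksFrom≡high+low true (suc u) r s
blocksFrom≡high+low p u (suc r) (D ∷ s) = blocksFrom≡high+low false u r s
blocksFrom≡high+low p u zero    (D ∷ s) with p ∧ (u ≡ᵇ 1)
... | true  = trans (cong suc (blocksFrom≡high+low false 0 (pred u) s)) (sym (+-suc _ _))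
... | false = cong suc (blocksFrom≡high+low false 0 (pred u) s)

peaksAfter : Bool → List Step → ℕ
peaksAfter p []      = 0
peaksAfter p (U ∷ s) = peaksAfter true s
peaksAfter p (D ∷ s) = (if p then 1 else 0) + peaksAfter false s

peaks≡peaksAfter : ∀ s → peaks s ≡ peaksAfter false s
peaks≡peaksAfter []      = refl
peaks≡peaksAfter (U ∷ s) = peaks-U s
  where
  peaks-U : ∀ s → peaks (U ∷ s) ≡ peaksAfter true s
  peaks-U []      = refl
  peaks-U (U ∷ s) = peaks-U s
  peaks-U (D ∷ s) = cong suc (peaks≡peaksAfter s)
peaks≡peaksAfter (D ∷ s) = peaks≡peaksAfter s

bounceUp-U : ∀ h b s → bounceUp h b U s ≡ U ∷ bounceGo up (suc h) (suc b) s
bounceUp-U h b s rewrite ∧-zeroʳ (h ≡ᵇ b) = refl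

≡ᵇ-refl : ∀ n → (n ≡ᵇ n) ≡ true
≡ᵇ-refl n = dec-true (n ≟ n) refl

bounceUp-meet : ∀ b s → bounceUp b b D s ≡ D ∷ bounceGo down (pred b) (pred b) s
bounceUp-meet b s rewrite ≡ᵇ-refl b = refl

bounceUp-miss : ∀ h b s → h ≢ b → bounceUp h b D s ≡ U ∷ bounceGo up (pred h) (suc b) s
bounceUp-miss h b s h≢b rewrite dec-false (h ≟ b) h≢b = refl

-- The bounce path at height b against the block scan: while rising it is 2r below d, so it meets d
-- exactly at the down step closing a block.
data BounceState (u r : ℕ) : Mode → ℕ → Bool → Set where
  onAxis   : ∀ {p} → r + 0 ≡ u → BounceState u r up 0 p
  climbing : ∀ {b} → r + suc b ≡ u → BounceState u r up (suc b) true
  falling  : ∀ {b} → b + u ≡ r → BounceState u r down b false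

rising-gap : ∀ {u r b p} → BounceState u r up b p → r + b ≡ u
rising-gap (onAxis e)   = e
rising-gap (climbing e) = e

rising-misses : ∀ {u r b p} → BounceState u (suc r) up b p → suc (r + u) ≢ b
rising-misses {u} {r} {b} st = ≢-sym (<⇒≢ (s≤s (begin
  b         ≤⟨ m≤n+m b r ⟩
  r + b     <⟨ ≤-reflexive (rising-gap st) ⟩
  u         ≤⟨ m≤n+m u r ⟩
  r + u     ∎)))
  where open ≤-Reasoning

mutual
  bounce-peaks : ∀ s {m h b u r p q} → h ≡ r + u → ValidFrom h s → BounceState u r m b p →
                 peaksAfter p (bounceGo m h b s) ≡ blocksFrom q u r s
  bounce-peaks []      _  _ _                  = refl
  bounce-peaks (x ∷ s) eh v st@(onAxis _)      = bounceUp-peaks x s eh v st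
  bounce-peaks (x ∷ s) eh v st@(climbing _)    = bounceUp-peaks x s eh v st
  bounce-peaks (x ∷ s) eh v (falling {zero} e) =
    bounceUp-peaks x s eh v (onAxis (trans (+-identityʳ _) (sym e)))
  bounce-peaks (U ∷ s) eh v (falling {suc b} e) =
    bounce-peaks s (suc-+-suc eh) (validFrom-U _ s v) (falling (trans (+-suc b _) e))
  bounce-peaks (D ∷ s) refl v (falling {suc b} refl) = bounce-peaks s refl v (falling refl)

  bounceUp-peaks : ∀ x s {h b u r p q} → h ≡ r + u → ValidFrom h (x ∷ s) →
                   (st : BounceState u r up b p) →
                   peaksAfter p (bounceUp h b x s) ≡ blocksFrom q u r (x ∷ s)
  bounceUp-peaks U s {h} {b} eh v st rewrite bounceUp-U h b s =
    bounce-peaks s (suc-+-suc eh) (validFrom-U _ s v)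
      (climbing (trans (+-suc _ _) (cong suc (rising-gap st))))
  bounceUp-peaks D s {r = zero} refl () (onAxis refl)
  bounceUp-peaks D s {r = zero} refl v (climbing {b} refl) rewrite bounceUp-meet (suc b) s =
    cong suc (bounce-peaks s (sym (+-identityʳ b)) v (falling (+-identityʳ b)))
  bounceUp-peaks D s {b = b} {u} {suc r} refl v st
    rewrite bounceUp-miss (suc (r + u)) b s (rising-misses st) =
    bounce-peaks s refl v (climbing (trans (+-suc r b) (rising-gap st)))

bpk≡blocks : ∀ d → ValidFrom 0 d → bpk d ≡ blocks d
bpk≡blocks d v = trans (peaks≡peaksAfter (bounce d)) (bounce-peaks d refl v (onAxis refl))

lowBlocks-after-U : ∀ {u r} s → 0 < r + u →
                    lowBlocksFrom true (suc u) r s ≡ lowBlocksFrom false (suc u) r s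
lowBlocks-after-U                  []      _  = refl
lowBlocks-after-U                  (U ∷ s) _  = refl
lowBlocks-after-U {r = suc r}      (D ∷ s) _  = refl
lowBlocks-after-U {suc u} {zero}   (D ∷ s) _  = refl
lowBlocks-after-U {zero}  {zero}   (D ∷ s) ()

lowBlocks≡lowPeaks : ∀ s {h u r} → h ≡ r + u → ValidFrom h s →
                     lowBlocksFrom false u r s ≡ lowPeaksFrom h s
lowBlocks≡lowPeaks []                                  _    _ = refl
lowBlocks≡lowPeaks (U ∷ s)     {suc h}                 eh   v =
  trans (lowBlocks-after-U s (subst (0 <_) eh (s≤s z≤n))) (lowBlocks≡lowPeaks s (suc-+-suc eh) v)
lowBlocks≡lowPeaks (U ∷ [])    {zero} {zero}  {zero}   _    _ = refl
lowBlocks≡lowPeaks (U ∷ D ∷ s) {zero} {zero}  {zero}   _    v = cong suc (lowBlocks≡lowPeaks s refl v)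
lowBlocks≡lowPeaks (U ∷ U ∷ s) {zero} {zero}  {zero}   _    v = lowBlocks≡lowPeaks (U ∷ s) refl v
lowBlocks≡lowPeaks (U ∷ s)     {zero} {suc u} {zero}   ()
lowBlocks≡lowPeaks (U ∷ s)     {zero} {u}     {suc r}  ()
lowBlocks≡lowPeaks (D ∷ s)     {suc h} {r = suc r}     refl v = lowBlocks≡lowPeaks s refl v
lowBlocks≡lowPeaks (D ∷ s)     {suc h} {r = zero}      refl v =
  lowBlocks≡lowPeaks s (sym (+-identityʳ h)) v

lpk≡lowBlocks : ∀ d → ValidFrom 0 d → lpk d ≡ lowBlocks d
lpk≡lowBlocks d v = sym (lowBlocks≡lowPeaks d refl v)

-- Lower bound

highWeight≤1 : ∀ b → (if b then 0 else 1) ≤ 1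
highWeight≤1 true  = z≤n
highWeight≤1 false = s≤s z≤n

module _ {_⊏_ : Rel ℕ 0ℓ} (⊏-sto : IsStrictTotalOrder _≡_ _⊏_) where
  open IsStrictTotalOrder ⊏-sto using (compare) renaming (_<?_ to _⊏?_; trans to ⊏-trans)

  -- The stretch of the word from U_M to D_M, a being the last letter read: none of it read yet,
  -- U_M just read, a above M, or a descent already found (one unit of credit).
  data Watch (M : ℕ) : ℕ → ℕ → Bool → ℕ → Set where
    closed   : ∀ {a p}   → Watch M 0 a p 0
    opened   :             Watch M 1 M true 0
    climbing : ∀ {u a p} → M ⊏ a → Watch M (suc u) a p 0
    paid     : ∀ {u a p} → Watch M u a p 1

  ⊏-climb : ∀ {M a b} → M ≡ a ⊎ M ⊏ a → ¬ b ⊏ a → M ≢ b → M ⊏ b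
  ⊏-climb {M} {a} {b} M⊑a b⊀a M≢b with compare a b | M⊑a
  ... | tri< a⊏b _ _ | inj₁ refl = a⊏b
  ... | tri< a⊏b _ _ | inj₂ M⊏a = ⊏-trans M⊏a a⊏b
  ... | tri≈ _ refl _ | inj₁ M≡a = contradiction M≡a M≢b
  ... | tri≈ _ refl _ | inj₂ M⊏a = M⊏a
  ... | tri> _ _ b⊏a | _ = contradiction b⊏a b⊀a

  -- _⊏?_ is computed from compare, so splitting on compare evaluates the descent indicator.
  advance : ∀ {M a b u q X rest} → M ≡ a ⊎ M ⊏ a → M ≢ b →
            (∀ {c} → Watch M (suc u) b q c → X ≤ c + rest) → X ≤ (if does (b ⊏? a) then 1 else 0) + rest
  advance {a = a} {b} M⊑a M≢b continue with compare b a
  ... | tri< _ _ _   = continue paid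
  ... | tri≈ b⊀a _ _ = continue (climbing (⊏-climb M⊑a b⊀a M≢b))
  ... | tri> b⊀a _ _ = continue (climbing (⊏-climb M⊑a b⊀a M≢b))

  return-descends : ∀ {M a} → M ⊏ a → 1 ≤ (if does (M ⊏? a) then 1 else 0)
  return-descends {M} {a} M⊏a with compare M a
  ... | tri< _ _ _    = s≤s z≤n
  ... | tri≈ M⊀a _ _ = contradiction M⊏a M⊀a
  ... | tri> M⊀a _ _ = contradiction M⊏a M⊀a

  highBlocksFrom≤descentsAfter : ∀ s {a M iu id u r p h c} → Watch M u a p c →
          r + id ≡ M → u + M ≡ iu → h ≡ r + u → ValidFrom h s →
          highBlocksFrom p u r s ≤ c + descentsAfter _⊏?_ a (canFrom (λ i → i) iu id s)
  highBlocksFrom≤descentsAfter [] _ _ _ _ _ = z≤n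
  highBlocksFrom≤descentsAfter (U ∷ s) closed eM refl eh v =
    ≤-trans (highBlocksFrom≤descentsAfter s opened eM refl (suc-+-suc eh) (validFrom-U _ s v))
            (m≤n+m _ _)
  highBlocksFrom≤descentsAfter (U ∷ s) paid eM eu eh v =
    ≤-trans (highBlocksFrom≤descentsAfter s paid eM (cong suc eu) (suc-+-suc eh) (validFrom-U _ s v))
            (+-monoʳ-≤ 1 (m≤n+m _ _))
  highBlocksFrom≤descentsAfter (U ∷ s) opened eM refl eh v =
    advance (inj₁ refl) (<⇒≢ ≤-refl)
      λ st → highBlocksFrom≤descentsAfter s st eM refl (suc-+-suc eh) (validFrom-U _ s v)
  highBlocksFrom≤descentsAfter (U ∷ s) {M = M} (climbing {u} M⊏a) eM eu eh v =
    advance (inj₂ M⊏a) (<⇒≢ (subst (M <_) eu (s≤s (m≤n+m M u))))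
      λ st → highBlocksFrom≤descentsAfter s st eM (cong suc eu) (suc-+-suc eh) (validFrom-U _ s v)
  highBlocksFrom≤descentsAfter (D ∷ s) {h = zero} _ _ _ _ ()
  highBlocksFrom≤descentsAfter (D ∷ s) {r = suc r} closed eM eu refl v =
    ≤-trans (highBlocksFrom≤descentsAfter s closed (trans (+-suc r _) eM) eu refl v) (m≤n+m _ _)
  highBlocksFrom≤descentsAfter (D ∷ s) {r = suc r} paid eM eu refl v =
    ≤-trans (highBlocksFrom≤descentsAfter s paid (trans (+-suc r _) eM) eu refl v)
            (+-monoʳ-≤ 1 (m≤n+m _ _))
  highBlocksFrom≤descentsAfter (D ∷ s) {id = id} {r = suc r} opened eM eu refl v =
    advance (inj₁ refl) (≢-sym (<⇒≢ (subst (id <_) eM (s≤s (m≤n+m id r)))))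
      λ st → highBlocksFrom≤descentsAfter s st (trans (+-suc r id) eM) eu refl v
  highBlocksFrom≤descentsAfter (D ∷ s) {id = id} {r = suc r} (climbing M⊏a) eM eu refl v =
    advance (inj₂ M⊏a) (≢-sym (<⇒≢ (subst (id <_) eM (s≤s (m≤n+m id r)))))
      λ st → highBlocksFrom≤descentsAfter s st (trans (+-suc r id) eM) eu refl v
  highBlocksFrom≤descentsAfter (D ∷ s) {id = id} {suc u} {zero} opened refl refl refl v =
    ≤-trans (highBlocksFrom≤descentsAfter s closed refl refl refl v) (m≤n+m _ _)
  highBlocksFrom≤descentsAfter (D ∷ s) {id = id} {suc u} {zero} (climbing M⊏a) refl eu refl v =
    +-mono-≤ (≤-trans (highWeight≤1 _) (return-descends M⊏a))
             (highBlocksFrom≤descentsAfter s closed (trans (+-suc u id) eu) refl (sym (+-identityʳ u)) v)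
  highBlocksFrom≤descentsAfter (D ∷ s) {id = id} {suc u} {zero} paid refl eu refl v =
    ≤-trans (+-mono-≤ (highWeight≤1 _)
               (highBlocksFrom≤descentsAfter s closed (trans (+-suc u id) eu) refl (sym (+-identityʳ u)) v))
            (+-monoʳ-≤ 1 (m≤n+m _ _))

  highBlocks≤descents : ∀ d → ValidFrom 0 d → highBlocks d ≤ descentsBy _⊏?_ (indexWord d)
  highBlocks≤descents []      _ = z≤n
  highBlocks≤descents (U ∷ s) v = highBlocksFrom≤descentsAfter s opened refl refl refl v

-- Keys and the upper bound

nth : List (List ℕ) → ℕ → List ℕ
nth []         _       = []
nth (xs ∷ xss) zero    = xs
nth (xs ∷ xss) (suc i) = nth xss i

nth-++ˡ : ∀ xss {yss} i → i < length xss → nth (xss ++ yss) i ≡ nth xss i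
nth-++ˡ (xs ∷ xss) zero    _         = refl
nth-++ˡ (xs ∷ xss) (suc i) (s≤s i<) = nth-++ˡ xss i i<

nth-∷ʳ : ∀ xss ys → nth (xss ∷ʳ ys) (length xss) ≡ ys
nth-∷ʳ []         ys = refl
nth-∷ʳ (xs ∷ xss) ys = nth-∷ʳ xss ys

length-∷ʳ : ∀ {A : Set} (xs : List A) x → length (xs ∷ʳ x) ≡ suc (length xs)
length-∷ʳ []       x = refl
length-∷ʳ (y ∷ xs) x = cong suc (length-∷ʳ xs x)

-- The key of U_i is the key of the last down step before it, extended by i; D_m has the key of
-- index m.
keyGen : List (List ℕ) → List ℕ → ℕ → List Step → List (List ℕ)
keyGen keys last id []      = keys
keyGen keys last id (U ∷ s) = keyGen (keys ∷ʳ (last ∷ʳ length keys)) last id s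
keyGen keys last id (D ∷ s) = keyGen keys (nth keys id) (suc id) s

key : List Step → ℕ → List ℕ
key d = nth (keyGen [] [] 0 d)

keyGen-prefix : ∀ s keys last id {i} → i < length keys → nth (keyGen keys last id s) i ≡ nth keys i
keyGen-prefix []      keys last id i< = refl
keyGen-prefix (U ∷ s) keys last id {i} i< =
  trans (keyGen-prefix s _ last id (subst (i <_) (sym (length-∷ʳ keys _)) (m<n⇒m<1+n i<)))
        (nth-++ˡ keys i i<)
keyGen-prefix (D ∷ s) keys last id i< = keyGen-prefix s keys (nth keys id) (suc id) i<

module _ (K : ℕ → List ℕ) where

  KeyOrder : Rel ℕ 0ℓ
  KeyOrder = ByKey <ₖ-isStrictTotalOrder K

  keyOrder-isStrictTotalOrder : IsStrictTotalOrder _≡_ KeyOrder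
  keyOrder-isStrictTotalOrder = byKey-isStrictTotalOrder <ₖ-isStrictTotalOrder K

  open IsStrictTotalOrder keyOrder-isStrictTotalOrder using (irrefl; asym) renaming (_<?_ to _⊏?_)

  record BlockKeys (lo hi ℓ : ℕ) : Set where
    field
      ascending : ∀ {x} → lo ≤ x → suc x < hi → K x <ₖ K (suc x)
      uniform   : ∀ {x} → lo ≤ x → x < hi → length (K x) ≡ ℓ
  open BlockKeys

  blockKeys-empty : ∀ {x ℓ} → BlockKeys x x ℓ
  blockKeys-empty = record
    { ascending = λ x≤y sy<x → contradiction (<-trans (≤-<-trans x≤y (n<1+n _)) sy<x) (<-irrefl refl)
    ; uniform   = λ x≤y y<x → contradiction (≤-<-trans x≤y y<x) (<-irrefl refl)
    }

  blockKeys-single : ∀ {x ℓ} → length (K x) ≡ ℓ → BlockKeys x (suc x) ℓ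
  blockKeys-single len = record
    { ascending = λ x≤y sy<sx → contradiction (≤-<-trans x≤y (≤-pred sy<sx)) (<-irrefl refl)
    ; uniform   = λ x≤y y<sx → subst (λ z → length (K z) ≡ _) (≤-antisym x≤y (≤-pred y<sx)) len
    }

  blockKeys-extend : ∀ {lo x ℓ} → BlockKeys lo (suc x) ℓ → K x <ₖ K (suc x) → length (K (suc x)) ≡ ℓ →
                     BlockKeys lo (suc (suc x)) ℓ
  blockKeys-extend block Kx<Ksx len = record
    { ascending = λ lo≤y sy<ssx → case m<1+n⇒m<n∨m≡n sy<ssx of λ
        { (inj₁ sy<sx) → ascending block lo≤y sy<sx
        ; (inj₂ refl)  → Kx<Ksx }
    ; uniform = λ lo≤y y<ssx → case m<1+n⇒m<n∨m≡n y<ssx of λ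
        { (inj₁ y<sx) → uniform block lo≤y y<sx
        ; (inj₂ refl) → len }
    }

  record UpKey (x : ℕ) (last : List ℕ) (ℓ : ℕ) : Set where
    field
      parent        : List ℕ
      key≡          : K x ≡ parent ∷ʳ x
      parent≤last   : parent ≡ last ⊎ parent <ₖ last
      parent-length : length parent ≡ ℓ

  upKey<ₖ : ∀ {x t last ℓ} → UpKey x last ℓ → length last ≡ ℓ → x < t → K x <ₖ last ∷ʳ t
  upKey<ₖ {x} {t} {last} k len-last x<t = subst (_<ₖ last ∷ʳ t) (sym key≡) (case parent≤last of λ
    { (inj₁ refl)   → <ₖ-last last x<t
    ; (inj₂ Q<last) → <ₖ-++ (trans parent-length (sym len-last)) Q<last (x ∷ []) (t ∷ []) })
    where open UpKey k

  parent<ₖ : ∀ {x last L ℓ} (k : UpKey x last ℓ) → last <ₖ L → UpKey.parent k <ₖ L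
  parent<ₖ k last<L with UpKey.parent≤last k
  ... | inj₁ refl   = last<L
  ... | inj₂ Q<last = <ₖ-trans Q<last last<L

  upKey-raise : ∀ {x last L ℓ} → UpKey x last ℓ → last <ₖ L → UpKey x L ℓ
  upKey-raise k last<L = record
    { parent        = parent
    ; key≡          = key≡
    ; parent≤last   = inj₂ (parent<ₖ k last<L)
    ; parent-length = parent-length
    }
    where open UpKey k

  upKey<ₖ-raised : ∀ {x last L ℓ} → UpKey x last ℓ → last <ₖ L → length L ≡ ℓ → K x <ₖ L
  upKey<ₖ-raised {x} {L = L} k last<L len =
    subst (_<ₖ L) (sym key≡) (<ₖ-++ˡ (trans parent-length (sym len)) (parent<ₖ k last<L) (x ∷ []))
    where open UpKey k

  data LastDown (last : List ℕ) (E : ℕ) : ℕ → ℕ → Set where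
    none : LastDown last E 0 0
    seen : ∀ {M i} → E ≤ i → last ≡ K i → LastDown last E M (suc i)

  data Previous : ℕ → ℕ → ℕ → Bool → ℕ → Set where
    afterUp   : ∀ {iu id u} → Previous (suc iu) id (suc u) true iu
    afterDown : ∀ {iu i u}  → Previous iu (suc i) u false i

  new-length : ∀ {iu last ℓ} → length last ≡ ℓ → K iu ≡ last ∷ʳ iu → length (K iu) ≡ suc ℓ
  new-length {iu} {last} len Kiu = trans (cong length Kiu) (trans (length-∷ʳ last iu) (cong suc len))

  -- [E, M) is the block now read by down steps, [M, iu) the block being collected, and last the key
  -- of the last down step read.
  record KeyInvariant (last : List ℕ) (iu u M E ℓ : ℕ) : Set where
    field
      downBlock   : BlockKeys E M ℓ
      upBlock     : BlockKeys M iu (suc ℓ)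
      last-length : length last ≡ ℓ
      lastUp      : 1 ≤ u → UpKey (pred iu) last ℓ

  Generates : List (List ℕ) → List ℕ → ℕ → List Step → Set
  Generates keys last id s = ∀ x → K x ≡ nth (keyGen keys last id s) x

  key-new : ∀ s keys last id {iu} → length keys ≡ iu → Generates keys last id (U ∷ s) → K iu ≡ last ∷ʳ iu
  key-new s keys last id refl gen = trans (gen (length keys))
    (trans (keyGen-prefix s _ last id (subst (length keys <_) (sym (length-∷ʳ keys _)) ≤-refl))
           (nth-∷ʳ keys _))

  key-old : ∀ s keys last id {i} → Generates keys last id s → i < length keys → nth keys i ≡ K i
  key-old s keys last id {i} gen i< = sym (trans (gen i) (keyGen-prefix s keys last id i<))

  no-key-descent : ∀ {a b rest X} → K a <ₖ K b → rest ≤ X → (if does (b ⊏? a) then 1 else 0) + rest ≤ X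
  no-key-descent {rest = rest} Ka<Kb rest≤X =
    subst (λ z → z + rest ≤ _) (sym (no-descent _⊏?_ (λ b⊏a → asym (inj₁ Ka<Kb) b⊏a))) rest≤X

  previous<up : ∀ {last E M iu id u ℓ p a} → LastDown last E M id → Previous iu id u p a →
                (1 ≤ u → UpKey (pred iu) last ℓ) → length last ≡ ℓ → K a <ₖ last ∷ʳ iu
  previous<up _                 afterUp   lastUp len = upKey<ₖ (lastUp (s≤s z≤n)) len ≤-refl
  previous<up (seen _ last≡Ki) afterDown _      _   = subst (_<ₖ _) last≡Ki (<ₖ-snoc _ _)

  previous<down : ∀ {last L iu i u ℓ p a} → Previous iu (suc i) u p a →
                  (1 ≤ u → UpKey (pred iu) last ℓ) → last ≡ K i → last <ₖ L → length L ≡ ℓ → K a <ₖ L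
  previous<down afterUp   lastUp _        last<L len = upKey<ₖ-raised (lastUp (s≤s z≤n)) last<L len
  previous<down afterDown _      last≡Ki last<L _   = subst (_<ₖ _) last≡Ki last<L

  push-up : ∀ {u M iu last ℓ} → u + M ≡ iu → BlockKeys M iu (suc ℓ) → (1 ≤ u → UpKey (pred iu) last ℓ) →
            length last ≡ ℓ → K iu ≡ last ∷ʳ iu → BlockKeys M (suc iu) (suc ℓ)
  push-up {zero}  refl _     _      len Kiu = blockKeys-single (new-length len Kiu)
  push-up {suc u} refl block lastUp len Kiu =
    blockKeys-extend block (subst (_ <ₖ_) (sym Kiu) (upKey<ₖ (lastUp (s≤s z≤n)) len ≤-refl))
                           (new-length len Kiu)

  close-block : ∀ {id u p a rest X} → Previous (suc (u + id)) id (suc u) p a → rest ≤ X →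
                (if does (id ⊏? a) then 1 else 0) + rest ≤ (if p ∧ (suc u ≡ᵇ 1) then 0 else 1) + X
  close-block {u = zero}  afterUp   rest≤X =
    subst (λ z → z + _ ≤ _) (sym (no-descent _⊏?_ (irrefl refl))) rest≤X
  close-block {u = suc u} afterUp   rest≤X = +-mono-≤ (indicator≤1 _) rest≤X
  close-block             afterDown rest≤X = +-mono-≤ (indicator≤1 _) rest≤X

  descentsAfter≤highBlocksFrom : ∀ s {keys last iu id u r M E ℓ p a h} →
           length keys ≡ iu → Generates keys last id s →
           r + id ≡ M → u + M ≡ iu → h ≡ r + u → ValidFrom h s →
           LastDown last E M id → Previous iu id u p a → KeyInvariant last iu u M E ℓ →
           descentsAfter _⊏?_ a (canFrom (λ i → i) iu id s) ≤ highBlocksFrom p u r s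
  descentsAfter≤highBlocksFrom [] _ _ _ _ _ _ _ _ _ = z≤n
  descentsAfter≤highBlocksFrom (U ∷ s) {keys} {last} len gen rM uM eh v lastD prev inv =
    no-key-descent (subst (_ <ₖ_) (sym Kiu) (previous<up lastD prev lastUp last-length))
      (descentsAfter≤highBlocksFrom s (trans (length-∷ʳ keys _) (cong suc len)) gen
        rM (cong suc uM) (suc-+-suc eh) (validFrom-U _ s v) lastD afterUp record
          { downBlock   = downBlock
          ; upBlock     = push-up uM upBlock lastUp last-length Kiu
          ; last-length = last-length
          ; lastUp      = λ _ → record
              { parent = last ; key≡ = Kiu ; parent≤last = inj₁ refl ; parent-length = last-length }
          })
    where
    open KeyInvariant inv
    Kiu : K _ ≡ last ∷ʳ _
    Kiu = key-new s keys last _ len gen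
  descentsAfter≤highBlocksFrom (D ∷ s) {h = zero} _ _ _ _ _ () _ _ _
  descentsAfter≤highBlocksFrom (D ∷ s) {r = suc r} _ _ () _ _ _ none _ _
  descentsAfter≤highBlocksFrom (D ∷ s) {keys} {last} {iu} {suc i} {u} {suc r} {M}
                               len gen rM uM refl v (seen E≤i last≡Ki) prev inv =
    no-key-descent (previous<down prev lastUp last≡Ki last<Ksi len-Ksi)
      (descentsAfter≤highBlocksFrom s len gen (trans (+-suc r (suc i)) rM) uM refl v
        (seen (≤-trans E≤i (n≤1+n i)) nth≡Ksi) afterDown record
        { downBlock   = downBlock
        ; upBlock     = upBlock
        ; last-length = trans (cong length nth≡Ksi) len-Ksi
        ; lastUp      = λ u≥1 → upKey-raise (lastUp u≥1) (subst (last <ₖ_) (sym nth≡Ksi) last<Ksi)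
        })
    where
    open KeyInvariant inv
    si<M : suc i < M
    si<M = subst (suc i <_) rM (s≤s (m≤n+m (suc i) r))
    nth≡Ksi : nth keys (suc i) ≡ K (suc i)
    nth≡Ksi = key-old (D ∷ s) keys last (suc i) gen
                (subst (suc i <_) (sym len) (<-≤-trans si<M (subst (M ≤_) uM (m≤n+m M u))))
    last<Ksi : last <ₖ K (suc i)
    last<Ksi = subst (_<ₖ K (suc i)) (sym last≡Ki) (ascending downBlock E≤i si<M)
    len-Ksi : length (K (suc i)) ≡ _
    len-Ksi = uniform downBlock (≤-trans E≤i (n≤1+n i)) si<M
  descentsAfter≤highBlocksFrom (D ∷ s) {keys} {last} {iu} {id} {suc u} {zero}
                               len gen refl refl refl v lastD prev inv =
    close-block prev
      (descentsAfter≤highBlocksFrom s len gen (+-suc u id) refl (sym (+-identityʳ u)) v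
        (seen ≤-refl nth≡Kid) afterDown record
        { downBlock   = upBlock
        ; upBlock     = blockKeys-empty
        ; last-length = trans (cong length nth≡Kid) (uniform upBlock ≤-refl id<iu)
        ; lastUp      = λ ()
        })
    where
    open KeyInvariant inv
    id<iu : id < suc (u + id)
    id<iu = s≤s (m≤n+m id u)
    nth≡Kid : nth keys id ≡ K id
    nth≡Kid = key-old (D ∷ s) keys last id gen (subst (id <_) (sym len) id<iu)

keyDescents≤highBlocks : ∀ d → ValidFrom 0 d →
  descentsBy (IsStrictTotalOrder._<?_ (keyOrder-isStrictTotalOrder (key d))) (indexWord d) ≤ highBlocks d
keyDescents≤highBlocks []      _ = z≤n
keyDescents≤highBlocks (U ∷ s) v =
  descentsAfter≤highBlocksFrom (key (U ∷ s)) s refl (λ _ → refl) refl refl refl v none afterUp record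
    { downBlock   = blockKeys-empty (key (U ∷ s))
    ; upBlock     = blockKeys-single (key (U ∷ s)) (cong length first-key)
    ; last-length = refl
    ; lastUp      = λ _ → record
        { parent = [] ; key≡ = first-key ; parent≤last = inj₁ refl ; parent-length = refl }
    }
  where
  first-key : key (U ∷ s) 0 ≡ 0 ∷ []
  first-key = keyGen-prefix s ((0 ∷ []) ∷ []) [] 0 (s≤s z≤n)

module _ {_⊏_ : Rel ℕ 0ℓ} (⊏-sto : IsStrictTotalOrder _≡_ _⊏_) {n : ℕ} (f : ℕ → ℕ)
         (monotone : ∀ {a b} → a < n → b < n → a ⊏ b → f a < f b) where
  open IsStrictTotalOrder ⊏-sto using (compare)

  monotone⇒agree : ∀ {a b} → a < n → b < n → f a < f b ⇔ a ⊏ b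
  monotone⇒agree {a} {b} a<n b<n = mk⇔ reflect (monotone a<n b<n)
    where
    reflect : f a < f b → a ⊏ b
    reflect fa<fb with compare a b
    ... | tri< a⊏b _ _ = a⊏b
    ... | tri≈ _ refl _ = contradiction fa<fb (<-irrefl refl)
    ... | tri> _ _ b⊏a = contradiction (monotone b<n a<n b⊏a) (<-asym fa<fb)

module _ {n : ℕ} (σ : Permutation′ n) where

  label-fromℕ< : ∀ {i} (i<n : i < n) → label σ i ≡ toℕ (σ ⟨$⟩ʳ fromℕ< i<n)
  label-fromℕ< {i} i<n with i <? n
  ... | yes _   = refl
  ... | no  i≮n = contradiction i<n i≮n

  σ-injective : Injective _≡_ _≡_ (σ ⟨$⟩ʳ_)
  σ-injective {i} {j} σi≡σj = trans (sym (inverseˡ σ)) (trans (cong (σ ⟨$⟩ˡ_) σi≡σj) (inverseˡ σ))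

  label-injective : ∀ {i j} → i < n → j < n → label σ i ≡ label σ j → i ≡ j
  label-injective {i} {j} i<n j<n eq = begin
    i                   ≡⟨ toℕ-fromℕ< i<n ⟨
    toℕ (fromℕ< i<n)    ≡⟨ cong toℕ (σ-injective (toℕ-injective (begin
        toℕ (σ ⟨$⟩ʳ fromℕ< i<n) ≡⟨ label-fromℕ< i<n ⟨
        label σ i                ≡⟨ eq ⟩
        label σ j                ≡⟨ label-fromℕ< j<n ⟩
        toℕ (σ ⟨$⟩ʳ fromℕ< j<n) ∎))) ⟩
    toℕ (fromℕ< j<n)    ≡⟨ toℕ-fromℕ< j<n ⟩
    j                   ∎
    where open ≡-Reasoning

  des≡descentsBy : ∀ d → des d σ ≡ descentsBy (λ a b → label σ a <? label σ b) (indexWord d)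
  des≡descentsBy d =
    trans (cong descents (canFrom-map (label σ) 0 0 d)) (descents-map (label σ) (indexWord d))

module _ (n : ℕ) (d : List Step) (dyck : IsDyck n d) where
  private
    valid : ValidFrom 0 d
    valid = proj₂ dyck
    indices<n : All (_< n) (indexWord d)
    indices<n = indexWord-bounded d dyck

  bpk≡highBlocks+lpk : bpk d ≡ highBlocks d + lpk d
  bpk≡highBlocks+lpk = begin
    bpk d                      ≡⟨ bpk≡blocks d valid ⟩
    blocks d                   ≡⟨ blocksFrom≡high+low false 0 0 d ⟩
    highBlocks d + lowBlocks d ≡⟨ cong (highBlocks d +_) (lpk≡lowBlocks d valid) ⟨
    highBlocks d + lpk d       ∎
    where open ≡-Reasoning

  highBlocks≤des : (σ : Permutation′ n) → highBlocks d ≤ des d σ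
  highBlocks≤des σ = subst (highBlocks d ≤_) (sym des≡) (highBlocks≤descents ⊏σ-sto d valid)
    where
    -- label σ is junk beyond n, so ties are broken by index to get a strict total order on ℕ
    ⊏σ-sto : IsStrictTotalOrder _≡_ (ByKey <-isStrictTotalOrder (label σ))
    ⊏σ-sto = byKey-isStrictTotalOrder <-isStrictTotalOrder (label σ)
    monotone : ∀ {a b} → a < n → b < n → ByKey <-isStrictTotalOrder (label σ) a b → label σ a < label σ b
    monotone a<n b<n (inj₁ σa<σb)         = σa<σb
    monotone a<n b<n (inj₂ (σa≡σb , a<b)) = contradiction (label-injective σ a<n b<n σa≡σb) (<⇒≢ a<b)
    des≡ : des d σ ≡ descentsBy (IsStrictTotalOrder._<?_ ⊏σ-sto) (indexWord d)
    des≡ = trans (des≡descentsBy σ d)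
                 (descentsBy-cong _ _ (monotone⇒agree ⊏σ-sto (label σ) monotone) indices<n)

  private
    ⊏-sto : IsStrictTotalOrder _≡_ (KeyOrder (key d))
    ⊏-sto = keyOrder-isStrictTotalOrder (key d)
    open Ranking (restrict-isStrictTotalOrder ⊏-sto n) using (rankPermutation)

  σ★ : Permutation′ n
  σ★ = proj₁ rankPermutation

  des★≤highBlocks : des d σ★ ≤ highBlocks d
  des★≤highBlocks = subst (_≤ highBlocks d) (sym des≡) (keyDescents≤highBlocks d valid)
    where
    monotone : ∀ {a b} → a < n → b < n → KeyOrder (key d) a b → label σ★ a < label σ★ b
    monotone a<n b<n a⊏b = subst₂ _<_ (sym (label-fromℕ< σ★ a<n)) (sym (label-fromℕ< σ★ b<n))
      (proj₂ rankPermutation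
        (subst₂ (KeyOrder (key d)) (sym (toℕ-fromℕ< a<n)) (sym (toℕ-fromℕ< b<n)) a⊏b))
    des≡ : des d σ★ ≡ descentsBy (IsStrictTotalOrder._<?_ ⊏-sto) (indexWord d)
    des≡ = trans (des≡descentsBy σ★ d)
                 (descentsBy-cong _ _ (monotone⇒agree ⊏-sto (label σ★) monotone) indices<n)

corollary4p1 : (n : ℕ) (d : List Step) → IsDyck n d →
    (∃ λ (σ : Permutation′ n) → des d σ + lpk d ≡ bpk d)
    × ((σ : Permutation′ n) → bpk d ≤ des d σ + lpk d)
corollary4p1 n d dyck = (σ★ n d dyck , optimal) , bounded
  where
  optimal : des d (σ★ n d dyck) + lpk d ≡ bpk d
  optimal = begin
    des d (σ★ n d dyck) + lpk d ≡⟨ cong (_+ lpk d) (≤-antisym (des★≤highBlocks n d dyck)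
                                                               (highBlocks≤des n d dyck (σ★ n d dyck))) ⟩
    highBlocks d + lpk d        ≡⟨ bpk≡highBlocks+lpk n d dyck ⟨
    bpk d                       ∎
    where open ≡-Reasoning
  bounded : (σ : Permutation′ n) → bpk d ≤ des d σ + lpk d
  bounded σ = subst (_≤ des d σ + lpk d) (sym (bpk≡highBlocks+lpk n d dyck))
                    (+-monoˡ-≤ (lpk d) (highBlocks≤des n d dyck σ))
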